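{- If an atomic flow is normal for $\mathsf c$ (no rule of $\mathsf c$ applies to it), then all its $\mathsf{ai}$-paths are clean paths.
   Context: An atomic flow is a finite directed acyclic graph whose vertices are labelled interaction (0 upper edges, 2 lower edges), cointeraction (2 upper, 0 lower), weakening (0,1), coweakening (1,0), contraction (2,1) or cocontraction (1,2); edges may also have a dangling upper or lower end; there is a polarity assignment in $\{+,-\}$ with equal polarities on the edges of a (co)contraction and distinct ones on the two edges of a (co)interaction. A path is a sequence of edges $\epsilon_1,\dots,\epsilon_h$ where the lower end of $\epsilon_i$ is the upper end of $\epsilon_{i+1}$ (a path from the upper end of $\epsilon_1$ to the lower end of $\epsilon_h$), or the reverse of such a sequence. An $\mathsf{ai}$-path is either a path or (recursively) the concatenation $\epsilon_1,\dots,\epsilon_k,\epsilon_{k+1},\dots,\epsilon_h$ of an $\mathsf{ai}$-path ending at an interaction or cointeraction vertex $\nu$ and an $\mathsf{ai}$-path starting at $\nu$, with $\epsilon_k\neq\epsilon_{k+1}$. An $\mathsf{ai}$-connection is a path from an interaction vertex to a cointeraction vertex or vice versa; a simple edge is an $\mathsf{ai}$-connection of length one. A clean path is an $\mathsf{ai}$-path in which every $\mathsf{ai}$-connection is a simple edge. System $\mathsf c$ consists of three local rules: (1) a contraction with upper edges $\epsilon_1,\epsilon_2$ whose lower edge is an upper edge of a cointeraction with other upper edge $\epsilon_3$ is replaced by a cocontraction with upper edge $\epsilon_3$ and lower edges $\delta_1,\delta_2$ and two cointeractions with upper edges $\{\epsilon_1,\delta_1\}$, $\{\epsilon_2,\delta_2\}$;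 (2) an interaction with lower edges $\epsilon_3,\epsilon$, where $\epsilon$ is the upper edge of a cocontraction with lower edges $\epsilon_1,\epsilon_2$, is replaced by a contraction with lower edge $\epsilon_3$ and upper edges $\delta_1,\delta_2$ and two interactions with lower edges $\{\epsilon_1,\delta_1\}$, $\{\epsilon_2,\delta_2\}$; (3) a contraction whose lower edge is the upper edge of a cocontraction is replaced by two cocontractions (on the contraction's upper edges) and two contractions (on the cocontraction's lower edges), each cocontraction joined to each contraction by a new edge. -}

module Defs where

open import Data.Nat using (ℕ; zero; suc)
open import Data.Fin using (Fin) renaming (_≟_ to _≟F_)
open import Data.List using (List; []; _∷_; _++_; reverse; length; filter; head; last)
open import Data.List.Base using (allFin)
open import Data.Maybe using (Maybe; just; nothing)
open import Data.Maybe.Properties using (≡-dec)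
open import Data.Product using (Σ; ∃; ∃₂; _×_; _,_)
open import Data.Sum using (_⊎_)
open import Relation.Nullary using (¬_)
open import Relation.Binary.PropositionalEquality using (_≡_; _≢_)

data Kind : Set where
  interaction cointeraction weakening coweakening contraction cocontraction : Kind

-- number of upper edges (edges whose LOWER end is at the vertex)
nUpper : Kind → ℕ
nUpper interaction   = 0
nUpper cointeraction = 2
nUpper weakening     = 0
nUpper coweakening   = 1
nUpper contraction   = 2
nUpper cocontraction = 1

-- number of lower edges (edges whose UPPER end is at the vertex)
nLower : Kind → ℕ
nLower interaction   = 2
nLower cointeraction = 0
nLower weakening     = 1
nLower coweakening   = 0
nLower contraction   = 1
nLower cocontraction = 2

data Polarity : Set where
  plus minus : Polarity

-- Downward paths in a graph given by the endpoint maps of its edges.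
-- upE e = vertex at the upper end of e (nothing = dangling),
-- downE e = vertex at the lower end of e (nothing = dangling).

module _ {V E : ℕ} (upE downE : Fin E → Maybe (Fin V)) where

  data DownPath : List (Fin E) → Maybe (Fin V) → Maybe (Fin V) → Set where
    edge : (e : Fin E) → DownPath (e ∷ []) (upE e) (downE e)
    step : (e : Fin E) {es : List (Fin E)} {w : Fin V} {t : Maybe (Fin V)} →
           downE e ≡ just w → DownPath es (just w) t →
           DownPath (e ∷ es) (upE e) t

incident : {V E : ℕ} → (Fin E → Maybe (Fin V)) → (Fin E → Maybe (Fin V)) →
           Fin E → Fin V → Set
incident upE downE e v = (upE e ≡ just v) ⊎ (downE e ≡ just v)

record AtomicFlow : Set where
  field
    V     : ℕ
    E     : ℕ
    label : Fin V → Kind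
    upE   : Fin E → Maybe (Fin V)
    downE : Fin E → Maybe (Fin V)
    pol   : Fin E → Polarity
    upperArity : (v : Fin V) →
      length (filter (λ e → ≡-dec _≟F_ (downE e) (just v)) (allFin E)) ≡ nUpper (label v)
    lowerArity : (v : Fin V) →
      length (filter (λ e → ≡-dec _≟F_ (upE e) (just v)) (allFin E)) ≡ nLower (label v)
    acyclic : (v : Fin V) (es : List (Fin E)) → ¬ DownPath upE downE es (just v) (just v)
    polContr : (v : Fin V) → (label v ≡ contraction ⊎ label v ≡ cocontraction) →
      (e e' : Fin E) → incident upE downE e v → incident upE downE e' v → pol e ≡ pol e'
    polInter : (v : Fin V) → (label v ≡ interaction ⊎ label v ≡ cointeraction) →
      (e e' : Fin E) → incident upE downE e v → incident upE downE e' v → e ≢ e' →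
      pol e ≢ pol e'

module _ (F : AtomicFlow) where
  open AtomicFlow F

  Pt : Set
  Pt = Maybe (Fin V)

  Path : List (Fin E) → Pt → Pt → Set
  Path es s t = DownPath upE downE es s t
              ⊎ Σ (List (Fin E)) (λ es' → (es ≡ reverse es') × DownPath upE downE es' t s)

  isAiVertex : Fin V → Set
  isAiVertex ν = (label ν ≡ interaction) ⊎ (label ν ≡ cointeraction)

  data AiPath : List (Fin E) → Pt → Pt → Set where
    path : {es : List (Fin E)} {s t : Pt} → Path es s t → AiPath es s t
    join : {es₁ es₂ : List (Fin E)} {s t : Pt} (ν : Fin V) →
           AiPath es₁ s (just ν) → AiPath es₂ (just ν) t → isAiVertex ν →
           last es₁ ≢ head es₂ → AiPath (es₁ ++ es₂) s t

  AiConnection : List (Fin E) → Set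
  AiConnection es = ∃₂ λ ν μ → Path es (just ν) (just μ) ×
    ((label ν ≡ interaction × label μ ≡ cointeraction)
     ⊎ (label ν ≡ cointeraction × label μ ≡ interaction))

  Segment : List (Fin E) → List (Fin E) → Set
  Segment seg es = ∃₂ λ xs ys → es ≡ xs ++ seg ++ ys

  CleanPath : List (Fin E) → Pt → Pt → Set
  CleanPath es s t = AiPath es s t ×
    ((seg : List (Fin E)) → Segment seg es → AiConnection seg → length seg ≡ 1)

  Redex1 : Set
  Redex1 = ∃₂ λ (ν μ : Fin V) → ∃ λ (ε : Fin E) →
    label ν ≡ contraction × label μ ≡ cointeraction × upE ε ≡ just ν × downE ε ≡ just μ
  Redex2 : Set
  Redex2 = ∃₂ λ (ν μ : Fin V) → ∃ λ (ε : Fin E) →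
    label ν ≡ interaction × label μ ≡ cocontraction × upE ε ≡ just ν × downE ε ≡ just μ
  Redex3 : Set
  Redex3 = ∃₂ λ (ν μ : Fin V) → ∃ λ (ε : Fin E) →
    label ν ≡ contraction × label μ ≡ cocontraction × upE ε ≡ just ν × downE ε ≡ just μ

  NormalC : Set
  NormalC = ¬ Redex1 × ¬ Redex2 × ¬ Redex3

module Submission where

-- In a flow that is normal for system c, every ai-path is clean: we show the
-- stronger fact that every ai-connection whatsoever is a single edge.
--
-- The argument looks only at the local shape of downward paths.
--   * Arity: an edge entering a vertex from above (resp. leaving it below)
--     forces that vertex to have an upper (resp. lower) edge.  Hence an
--     interior vertex of a downward path is a contraction or a cocontraction,
--     a downward path cannot start at a cointeraction nor end at an
--     interaction.
--   * Redexes: walking down a path from a contraction, the next vertex can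
--     be neither a cocontraction (rule 3) nor a cointeraction (rule 1), so no
--     downward path links a contraction to a cointeraction.  Starting at an
--     interaction, an interior vertex would be a cocontraction (rule 2) or a
--     contraction (previous fact), so an interaction reaches a cointeraction
--     only through one edge.
-- An ai-connection is such a downward path or the reverse of one, and
-- reversal preserves length; this gives the theorem.

open import Defs
open import Data.List using (List)
open import Data.Fin using (Fin)

open import Data.Fin using () renaming (_≟_ to _≟F_)
open import Data.List using (_∷_; length)
open import Data.List.Membership.Propositional using (_∈_)
open import Data.List.Membership.Propositional.Properties using (∈-filter⁺; ∈-allFin)
open import Data.List.Properties using (length-reverse)
open import Data.Maybe using (just)
open import Data.Maybe.Properties using (≡-dec)
open import Data.Product using (∃; _,_; proj₂)
open import Data.Sum using (_⊎_; inj₁; inj₂)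
open import Data.Empty using (⊥; ⊥-elim)
open import Relation.Nullary using (¬_)
open import Relation.Binary.PropositionalEquality using (_≡_; refl; trans; cong)

member⇒length≢0 : {A : Set} {x : A} {xs : List A} → x ∈ xs → ¬ length xs ≡ 0
member⇒length≢0 {xs = _ ∷ _} _ ()

module _ (F : AtomicFlow) where
  open AtomicFlow F

  DownPath′ : List (Fin E) → Pt F → Pt F → Set
  DownPath′ = DownPath upE downE

  -- An edge whose lower end is v is counted among the upper edges of v,
  -- so the label of v must allow upper edges.
  enters⇒hasUpper : ∀ {e v} → downE e ≡ just v → ¬ nUpper (label v) ≡ 0
  enters⇒hasUpper {e} {v} d eq =
    member⇒length≢0 (∈-filter⁺ (λ x → ≡-dec _≟F_ (downE x) (just v)) (∈-allFin e) d)
                    (trans (upperArity v) eq)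

  leaves⇒hasLower : ∀ {e v} → upE e ≡ just v → ¬ nLower (label v) ≡ 0
  leaves⇒hasLower {e} {v} u eq =
    member⇒length≢0 (∈-filter⁺ (λ x → ≡-dec _≟F_ (upE x) (just v)) (∈-allFin e) u)
                    (trans (lowerArity v) eq)

  firstEdge : ∀ {es s t} → DownPath′ es s t → ∃ λ e → upE e ≡ s
  firstEdge (edge e)     = e , refl
  firstEdge (step e _ _) = e , refl

  lastEdge : ∀ {es s t} → DownPath′ es s t → ∃ λ e → downE e ≡ t
  lastEdge (edge e)     = e , refl
  lastEdge (step _ _ p) = lastEdge p

  throughVertex : ∀ {e e' w} → downE e ≡ just w → upE e' ≡ just w →
                  (label w ≡ contraction) ⊎ (label w ≡ cocontraction)
  throughVertex {w = w} d u with label w in eq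
  ... | interaction   = ⊥-elim (enters⇒hasUpper d (cong nUpper eq))
  ... | cointeraction = ⊥-elim (leaves⇒hasLower u (cong nLower eq))
  ... | weakening     = ⊥-elim (enters⇒hasUpper d (cong nUpper eq))
  ... | coweakening   = ⊥-elim (leaves⇒hasLower u (cong nLower eq))
  ... | contraction   = inj₁ refl
  ... | cocontraction = inj₂ refl

  interiorVertex : ∀ {e es w t} → downE e ≡ just w → DownPath′ es (just w) t →
                   (label w ≡ contraction) ⊎ (label w ≡ cocontraction)
  interiorVertex d p = throughVertex d (proj₂ (firstEdge p))

  -- Without redexes of rules 1 and 3, no downward path runs from a
  -- contraction to a cointeraction: its first edge would end at a
  -- cocontraction (rule 3), a cointeraction (rule 1) or another contraction.
  noContractionToCointeraction : ¬ Redex1 F → ¬ Redex3 F →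
    ∀ {es s t a b} → DownPath′ es s t → s ≡ just a → t ≡ just b →
    label a ≡ contraction → label b ≡ cointeraction → ⊥
  noContractionToCointeraction ¬r1 ¬r3 (edge e) sa tb la lb =
    ¬r1 (_ , _ , e , la , lb , sa , tb)
  noContractionToCointeraction ¬r1 ¬r3 (step e d p) sa tb la lb with interiorVertex d p
  ... | inj₁ lw = noContractionToCointeraction ¬r1 ¬r3 p refl tb lw lb
  ... | inj₂ lw = ¬r3 (_ , _ , e , la , lw , sa , d)

  -- In a c-normal flow a downward path from an interaction to a
  -- cointeraction is a single edge: a second vertex would be a cocontraction
  -- (rule 2) or a contraction reaching a cointeraction.
  interactionToCointeraction : NormalC F →
    ∀ {es s t a b} → DownPath′ es s t → s ≡ just a → t ≡ just b →
    label a ≡ interaction → label b ≡ cointeraction → length es ≡ 1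
  interactionToCointeraction _ (edge e) _ _ _ _ = refl
  interactionToCointeraction (¬r1 , ¬r2 , ¬r3) (step e d p) sa tb la lb
    with interiorVertex d p
  ... | inj₁ lw = ⊥-elim (noContractionToCointeraction ¬r1 ¬r3 p refl tb lw lb)
  ... | inj₂ lw = ⊥-elim (¬r2 (_ , _ , e , la , lw , sa , d))

  -- A downward path between two ai-vertices goes from an interaction to a
  -- cointeraction, since cointeractions have no lower edges to start it and
  -- interactions no upper edges to end it; in a c-normal flow it is
  -- therefore a single edge.
  aiDownPath : NormalC F → ∀ {es a b} → DownPath′ es (just a) (just b) →
               isAiVertex F a → isAiVertex F b → length es ≡ 1
  aiDownPath _ p (inj₂ la) _ =
    ⊥-elim (leaves⇒hasLower (proj₂ (firstEdge p)) (cong nLower la))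
  aiDownPath _ p _ (inj₁ lb) =
    ⊥-elim (enters⇒hasUpper (proj₂ (lastEdge p)) (cong nUpper lb))
  aiDownPath N p (inj₁ la) (inj₂ lb) = interactionToCointeraction N p refl refl la lb

  aiConnection⇒simple : NormalC F → (seg : List (Fin E)) → AiConnection F seg →
                        length seg ≡ 1
  aiConnection⇒simple N _ (_ , _ , inj₁ p , inj₁ (lν , lμ)) =
    aiDownPath N p (inj₁ lν) (inj₂ lμ)
  aiConnection⇒simple N _ (_ , _ , inj₁ p , inj₂ (lν , lμ)) =
    aiDownPath N p (inj₂ lν) (inj₁ lμ)
  aiConnection⇒simple N _ (_ , _ , inj₂ (es' , refl , p) , inj₁ (lν , lμ)) =
    trans (length-reverse es') (aiDownPath N p (inj₂ lμ) (inj₁ lν))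
  aiConnection⇒simple N _ (_ , _ , inj₂ (es' , refl , p) , inj₂ (lν , lμ)) =
    trans (length-reverse es') (aiDownPath N p (inj₁ lμ) (inj₂ lν))

proposition4p18 : (F : AtomicFlow) → NormalC F →
    (es : List (Fin (AtomicFlow.E F))) (s t : Pt F) →
    AiPath F es s t → CleanPath F es s t
proposition4p18 F N es s t p = p , λ seg _ → aiConnection⇒simple F N seg
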